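{- For every integer $k\ge 5$, there is a neighbor-locating coloring of the comb $B_{k(k-1)}$ using $k$ colors.
   Context: For $m\ge 3$, the comb $B_m$ is the tree obtained from the path $P_m$ of order $m$ by attaching one new leaf to each vertex of the path (so $B_m$ has $2m$ vertices). A $k$-coloring of a graph $G$ is a partition of $V(G)$ into $k$ independent sets (colors). A coloring $\{S_1,\dots,S_k\}$ is neighbor-locating if for any two distinct vertices $u,v$ in the same color class, $\{j: N(u)\cap S_j\neq\emptyset\}\neq\{j: N(v)\cap S_j\neq\emptyset\}$. -}

module Defs where

open import Data.Nat using (ℕ; suc; _+_; _*_; _∸_)
open import Data.Fin using (Fin; toℕ)
open import Data.Sum using (_⊎_; inj₁; inj₂)
open import Data.Product using (_×_; ∃; ∃-syntax; _,_)
open import Data.Empty using (⊥)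
open import Relation.Nullary using (¬_)
open import Relation.Binary.PropositionalEquality using (_≡_)
open import Level using (0ℓ)

record Graph : Set₁ where
  field
    V     : Set
    Adj   : V → V → Set

open Graph public

-- The comb B_m: path vertices (inj₁ i), leaf vertices (inj₂ i);
-- path vertices i, j adjacent iff |i - j| = 1; leaf i adjacent only to path vertex i.
CombAdj : (m : ℕ) → Fin m ⊎ Fin m → Fin m ⊎ Fin m → Set
CombAdj m (inj₁ i) (inj₁ j) = (suc (toℕ i) ≡ toℕ j) ⊎ (suc (toℕ j) ≡ toℕ i)
CombAdj m (inj₁ i) (inj₂ j) = i ≡ j
CombAdj m (inj₂ i) (inj₁ j) = i ≡ j
CombAdj m (inj₂ i) (inj₂ j) = ⊥

Comb : ℕ → Graph
Comb m = record { V = Fin m ⊎ Fin m ; Adj = CombAdj m }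

-- A k-coloring: a map to Fin k whose fibres (the colour classes S_1..S_k)
-- are independent and nonempty, i.e. a partition of V(G) into k independent sets.
record IsColoring (G : Graph) (k : ℕ) (c : V G → Fin k) : Set where
  field
    proper   : ∀ u v → Adj G u v → ¬ (c u ≡ c v)
    nonempty : ∀ (j : Fin k) → ∃[ v ] (c v ≡ j)

SeesColor : (G : Graph) {k : ℕ} (c : V G → Fin k) → V G → Fin k → Set
SeesColor G c u j = ∃[ w ] (Adj G u w × c w ≡ j)

SameNbrColors : (G : Graph) {k : ℕ} (c : V G → Fin k) → V G → V G → Set
SameNbrColors G c u v = ∀ j → (SeesColor G c u j → SeesColor G c v j)
                              × (SeesColor G c v j → SeesColor G c u j)

IsNeighborLocating : (G : Graph) (k : ℕ) (c : V G → Fin k) → Set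
IsNeighborLocating G k c =
  ∀ u v → ¬ (u ≡ v) → c u ≡ c v → ¬ SameNbrColors G c u v

NLColoring : (G : Graph) (k : ℕ) → Set
NLColoring G k = ∃[ c ] (IsColoring G k c × IsNeighborLocating G k c)

module Submission where

-- A colouring of the comb is described by two colour sequences along the
-- path: P i for path vertex i and L i for its leaf.  A leaf sees only the
-- colour of its stem, a path vertex sees its leaf colour and the colours of
-- its path neighbours.
--
-- Colours are 0, …, k−1; writing L i = P i ⊕ d (addition mod k) with offset
-- d ∈ {1, …, k−1}, the m = k(k−1) pairs (P i, L i) are exactly all pairs of
-- distinct colours.  The construction follows the paper: an odd run with
-- colours 2⌊k/2⌋−1, …, 3, 1, a cyclic run of k−2 sweeps 0, 1, …, k−1 whose
-- t-th sweep uses offset k−2−t, and an even run 0, 2, 4, …; both sparse runs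
-- use offset k−1.  Same-coloured vertices on a sparse and the cyclic run are
-- told apart by the next colour P ⊕ 1; two on the cyclic run by a leaf colour.

open import Defs
open import Data.Nat using (ℕ; _≤_; _*_; _∸_)
open import Data.Nat as ℕ using (zero; suc; _+_; _<_; z≤n; s≤s; pred; NonZero; ⌊_/2⌋; ⌈_/2⌉; _≟_; _<?_)
open import Data.Nat.Properties
open import Data.Nat.DivMod
open import Data.Fin using (Fin; toℕ; fromℕ<)
open import Data.Fin.Properties using (toℕ-injective; toℕ<n; toℕ-fromℕ<)
open import Data.Sum using (_⊎_; inj₁; inj₂)
open import Data.Product using (_×_; ∃; ∃₂; _,_; proj₁; proj₂)
open import Data.Empty using (⊥-elim)
open import Function using (_∘_)
open import Relation.Nullary using (¬_; yes; no)
open import Relation.Binary.PropositionalEquality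

PathSees : ℕ → (ℕ → ℕ) → (ℕ → ℕ) → ℕ → ℕ → Set
PathSees m P L i x = x ≡ L i ⊎ (0 < i × x ≡ P (pred i)) ⊎ (suc i < m × x ≡ P (suc i))

-- A leaf sees only its stem colour, which explains the
-- leaf conditions; a path vertex sees the colours described by PathSees.
record LocatingPattern (m k : ℕ) (P L : ℕ → ℕ) : Set where
  field
    path<k          : ∀ {i} → i < m → P i < k
    leaf<k          : ∀ {i} → i < m → L i < k
    path-proper     : ∀ {i} → suc i < m → P i ≢ P (suc i)
    leaf-proper     : ∀ {i} → i < m → L i ≢ P i
    leaf-separated  : ∀ {i j} → i < m → j < m → P i ≡ P j → L i ≡ L j → i ≡ j
    -- a path vertex sees two colours, so it is never confused with a leaf
    path-sees-two   : ∀ {i} → i < m →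
                      ∃₂ λ x y → PathSees m P L i x × PathSees m P L i y × x ≢ y
    path-separated  : ∀ {i j} → i < m → j < m → i ≢ j → P i ≡ P j →
                      ∃ λ x → (PathSees m P L i x × ¬ PathSees m P L j x)
                            ⊎ (PathSees m P L j x × ¬ PathSees m P L i x)
    path-onto       : ∀ {x} → x < k → ∃ λ i → i < m × P i ≡ x

module PatternColouring {m k : ℕ} {P L : ℕ → ℕ} (pat : LocatingPattern m k P L) where
  open LocatingPattern pat

  colour : Fin m ⊎ Fin m → Fin k
  colour (inj₁ i) = fromℕ< (path<k (toℕ<n i))
  colour (inj₂ i) = fromℕ< (leaf<k (toℕ<n i))

  colour-path : ∀ i → toℕ (colour (inj₁ i)) ≡ P (toℕ i)
  colour-path i = toℕ-fromℕ< _

  colour-leaf : ∀ i → toℕ (colour (inj₂ i)) ≡ L (toℕ i)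
  colour-leaf i = toℕ-fromℕ< _

  Sees : Fin m ⊎ Fin m → Fin k → Set
  Sees = SeesColor (Comb m) colour

  Sees′ : ℕ → ℕ → Set
  Sees′ = PathSees m P L

  sees<k : ∀ {i x} → i < m → Sees′ i x → x < k
  sees<k i<m (inj₁ refl)                = leaf<k i<m
  sees<k i<m (inj₂ (inj₁ (_ , refl)))   = path<k (≤-<-trans pred[n]≤n i<m)
  sees<k i<m (inj₂ (inj₂ (lt , refl)))  = path<k lt

  path-sees : ∀ i c → Sees (inj₁ i) c → Sees′ (toℕ i) (toℕ c)
  path-sees i c (inj₁ j , inj₁ i+1≡j , refl) =
    inj₂ (inj₂ (subst (_< m) (sym i+1≡j) (toℕ<n j) , trans (colour-path j) (cong P (sym i+1≡j))))
  path-sees i c (inj₁ j , inj₂ j+1≡i , refl) =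
    inj₂ (inj₁ (subst (0 <_) j+1≡i (s≤s z≤n) , trans (colour-path j) (cong (P ∘ pred) j+1≡i)))
  path-sees i c (inj₂ i , refl , refl) = inj₁ (colour-leaf i)

  sees-path : ∀ i {x} (x<k : x < k) → Sees′ (toℕ i) x → Sees (inj₁ i) (fromℕ< x<k)
  sees-path i x<k (inj₁ refl) =
    inj₂ i , refl , toℕ-injective (trans (colour-leaf i) (sym (toℕ-fromℕ< x<k)))
  sees-path i x<k (inj₂ (inj₁ (0<i , refl))) =
    inj₁ j , inj₂ (trans (cong suc (toℕ-fromℕ< _)) (suc-pred (toℕ i) {{ℕ.>-nonZero 0<i}})) ,
    toℕ-injective (trans (colour-path j) (trans (cong P (toℕ-fromℕ< _)) (sym (toℕ-fromℕ< x<k))))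
    where j = fromℕ< (≤-<-trans pred[n]≤n (toℕ<n i))
  sees-path i x<k (inj₂ (inj₂ (i+1<m , refl))) =
    inj₁ j , inj₁ (sym (toℕ-fromℕ< _)) ,
    toℕ-injective (trans (colour-path j) (trans (cong P (toℕ-fromℕ< _)) (sym (toℕ-fromℕ< x<k))))
    where j = fromℕ< i+1<m

  leaf-sees : ∀ i c → Sees (inj₂ i) c → toℕ c ≡ P (toℕ i)
  leaf-sees i c (inj₁ i , refl , refl) = colour-path i

  sees-stem : ∀ i → Sees (inj₂ i) (colour (inj₁ i))
  sees-stem i = inj₁ i , refl , refl

  Same : Fin m ⊎ Fin m → Fin m ⊎ Fin m → Set
  Same = SameNbrColors (Comb m) colour

  same-sym : ∀ {u v} → Same u v → Same v u
  same-sym same c = proj₂ (same c) , proj₁ (same c)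

  transfer-path : ∀ i j {x} → Same (inj₁ i) (inj₁ j) → Sees′ (toℕ i) x → Sees′ (toℕ j) x
  transfer-path i j same s = subst (Sees′ (toℕ j)) (toℕ-fromℕ< x<k)
    (path-sees j _ (proj₁ (same _) (sees-path i x<k s)))
    where x<k = sees<k (toℕ<n i) s

  transfer-leaf : ∀ i j {x} → Same (inj₁ i) (inj₂ j) → Sees′ (toℕ i) x → x ≡ P (toℕ j)
  transfer-leaf i j same s = trans (sym (toℕ-fromℕ< x<k))
    (leaf-sees j _ (proj₁ (same _) (sees-path i x<k s)))
    where x<k = sees<k (toℕ<n i) s

  path≢leaf : ∀ i j → ¬ Same (inj₁ i) (inj₂ j)
  path≢leaf i j same with path-sees-two (toℕ<n i)
  ... | x , y , sx , sy , x≢y = x≢y (trans (transfer-leaf i j same sx) (sym (transfer-leaf i j same sy)))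

  isColouring : IsColoring (Comb m) k colour
  isColouring = record { proper = proper ; nonempty = nonempty }
    where
    proper : ∀ u v → CombAdj m u v → colour u ≢ colour v
    proper (inj₁ i) (inj₁ j) (inj₁ i+1≡j) eq = path-proper (subst (_< m) (sym i+1≡j) (toℕ<n j))
      (trans (sym (colour-path i)) (trans (cong toℕ eq) (trans (colour-path j) (cong P (sym i+1≡j)))))
    proper (inj₁ i) (inj₁ j) (inj₂ j+1≡i) eq = path-proper (subst (_< m) (sym j+1≡i) (toℕ<n i))
      (trans (sym (colour-path j)) (trans (cong toℕ (sym eq)) (trans (colour-path i) (cong P (sym j+1≡i)))))
    proper (inj₁ i) (inj₂ i) refl eq = leaf-proper (toℕ<n i)
      (trans (sym (colour-leaf i)) (trans (cong toℕ (sym eq)) (colour-path i)))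
    proper (inj₂ i) (inj₁ i) refl eq = leaf-proper (toℕ<n i)
      (trans (sym (colour-leaf i)) (trans (cong toℕ eq) (colour-path i)))

    nonempty : ∀ c → ∃ λ v → colour v ≡ c
    nonempty c with path-onto (toℕ<n c)
    ... | i , i<m , Pi≡c = inj₁ (fromℕ< i<m) ,
      toℕ-injective (trans (colour-path _) (trans (cong P (toℕ-fromℕ< i<m)) Pi≡c))

  isLocating : IsNeighborLocating (Comb m) k colour
  isLocating (inj₁ i) (inj₁ j) i≢j eq same
    with path-separated (toℕ<n i) (toℕ<n j) (λ e → i≢j (cong inj₁ (toℕ-injective e)))
           (trans (sym (colour-path i)) (trans (cong toℕ eq) (colour-path j)))
  ... | _ , inj₁ (si , ¬sj) = ¬sj (transfer-path i j same si)
  ... | _ , inj₂ (sj , ¬si) = ¬si (transfer-path j i (same-sym same) sj)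
  isLocating (inj₁ i) (inj₂ j) _ _ same = path≢leaf i j same
  isLocating (inj₂ i) (inj₁ j) _ _ same = path≢leaf j i (same-sym same)
  isLocating (inj₂ i) (inj₂ j) i≢j eq same = i≢j (cong inj₂ (toℕ-injective
    (leaf-separated (toℕ<n i) (toℕ<n j) (trans (sym (colour-path i)) stem-colours)
      (trans (sym (colour-leaf i)) (trans (cong toℕ eq) (colour-leaf j))))))
    where
    stem-colours : toℕ (colour (inj₁ i)) ≡ P (toℕ j)
    stem-colours = leaf-sees j _ (proj₁ (same _) (sees-stem i))

pattern⇒NLColoring : ∀ {m k P L} → LocatingPattern m k P L → NLColoring (Comb m) k
pattern⇒NLColoring pat = colour , isColouring , isLocating
  where open PatternColouring pat

module ModularAddition (n : ℕ) .{{_ : NonZero n}} where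

  infixl 6 _⊕_
  _⊕_ : ℕ → ℕ → ℕ
  a ⊕ d = (a + d) % n

  ⊕<n : ∀ a d → a ⊕ d < n
  ⊕<n a d = m%n<n (a + d) n

  ⊕-identityʳ : ∀ {a} → a < n → a ⊕ 0 ≡ a
  ⊕-identityʳ {a} a<n = trans (cong (_% n) (+-identityʳ a)) (m<n⇒m%n≡m a<n)

  %-⊕ : ∀ a d → (a + d) % n ≡ a % n ⊕ d
  %-⊕ a d = begin
    (a + d) % n                ≡⟨ %-distribˡ-+ a d n ⟩
    (a % n + d % n) % n        ≡⟨ cong (λ x → (x + d % n) % n) (m%n%n≡m%n a n) ⟨
    ((a % n) % n + d % n) % n  ≡⟨ %-distribˡ-+ (a % n) d n ⟨
    (a % n + d) % n            ∎
    where open ≡-Reasoning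

  ⊕-inverseˡ : ∀ {a d} → a ≤ n → d < n → a ⊕ d ⊕ (n ∸ a) ≡ d
  ⊕-inverseˡ {a} {d} a≤n d<n = begin
    ((a + d) % n + (n ∸ a)) % n  ≡⟨ %-⊕ (a + d) (n ∸ a) ⟨
    (a + d + (n ∸ a)) % n        ≡⟨ cong (_% n) rearrange ⟩
    (d + n) % n                  ≡⟨ [m+n]%n≡m%n d n ⟩
    d % n                        ≡⟨ m<n⇒m%n≡m d<n ⟩
    d                            ∎
    where
    open ≡-Reasoning
    rearrange : a + d + (n ∸ a) ≡ d + n
    rearrange = begin
      a + d + (n ∸ a)    ≡⟨ cong (_+ (n ∸ a)) (+-comm a d) ⟩
      d + a + (n ∸ a)    ≡⟨ +-assoc d a (n ∸ a) ⟩
      d + (a + (n ∸ a))  ≡⟨ cong (d +_) (m+[n∸m]≡n a≤n) ⟩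
      d + n              ∎

  ⊕-cancelˡ : ∀ {a d d′} → a ≤ n → d < n → d′ < n → a ⊕ d ≡ a ⊕ d′ → d ≡ d′
  ⊕-cancelˡ {a} a≤n d<n d′<n eq = begin
    _                ≡⟨ ⊕-inverseˡ a≤n d<n ⟨
    a ⊕ _ ⊕ (n ∸ a)  ≡⟨ cong (_⊕ (n ∸ a)) eq ⟩
    a ⊕ _ ⊕ (n ∸ a)  ≡⟨ ⊕-inverseˡ a≤n d′<n ⟩
    _                ∎
    where open ≡-Reasoning

  ⊕-pred : ∀ {a} → 0 < a → a < n → a ⊕ (n ∸ 1) ≡ pred a
  ⊕-pred {suc a} _ a<n = begin
    (suc a + (n ∸ 1)) % n  ≡⟨ cong (_% n) (+-suc a (n ∸ 1)) ⟨
    (a + suc (n ∸ 1)) % n  ≡⟨ cong (λ x → (a + x) % n) (suc-pred n) ⟩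
    (a + n) % n            ≡⟨ [m+n]%n≡m%n a n ⟩
    a % n                  ≡⟨ m<n⇒m%n≡m (<-trans (n<1+n a) a<n) ⟩
    a                      ∎
    where open ≡-Reasoning

  ⊕-suc : ∀ {a} → a < n → (a ⊕ 1 ≡ suc a) ⊎ (suc a ≡ n × a ⊕ 1 ≡ 0)
  ⊕-suc {a} a<n with suc a <? n
  ... | yes a+1<n = inj₁ (trans (cong (_% n) (+-comm a 1)) (m<n⇒m%n≡m a+1<n))
  ... | no a+1≮n  = inj₂ (a+1≡n , trans (cong (_% n) (trans (+-comm a 1) a+1≡n)) (n%n≡0 n))
    where a+1≡n = ≤-antisym a<n (≮⇒≥ a+1≮n)

double-suc : ∀ a → suc a + suc a ≡ suc (suc (a + a))
double-suc a = cong suc (+-suc a a)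

odd≢even : ∀ a b → suc (a + a) ≢ b + b
odd≢even a       zero    ()
odd≢even zero    (suc b) eq = 0≢1+n (trans (suc-injective eq) (+-suc b b))
odd≢even (suc a) (suc b) eq = odd≢even a b (suc-injective (suc-injective
  (trans (cong suc (sym (double-suc a))) (trans eq (double-suc b)))))

double-injective : ∀ {a b} → a + a ≡ b + b → a ≡ b
double-injective {a} {b} eq = trans (n≡⌊n+n/2⌋ a) (trans (cong ⌊_/2⌋ eq) (sym (n≡⌊n+n/2⌋ b)))

-- Path positions: the odd run i < #odd, the cyclic run #odd + j with
-- j < #cyc = (k−2)k, and the even run #odd + #cyc + q with q < #even.
module Construction (k-2 : ℕ) (3≤k-2 : 3 ≤ k-2) (#odd #even : ℕ)
  (#odd+#even≡k : #odd + #even ≡ suc (suc k-2))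
  (#odd≤#even : #odd ≤ #even) (#even≤1+#odd : #even ≤ suc #odd) where

  k-1 k : ℕ
  k-1 = suc k-2
  k   = suc k-1

  open ModularAddition k

  #cyc m : ℕ
  #cyc = k-2 * k
  m    = k * k-1

  5≤k : 5 ≤ k
  5≤k = s≤s (s≤s 3≤k-2)

  k≢small : ∀ {n} → n < 5 → k ≢ n
  k≢small n<5 k≡n = <⇒≱ n<5 (subst (5 ≤_) k≡n 5≤k)

  2≤#odd : 2 ≤ #odd
  2≤#odd = ≮⇒≥ λ #odd<2 → <⇒≱ (s≤s (s≤s (s≤s (s≤s z≤n)))) (≤-trans 5≤k
    (subst (_≤ 3) #odd+#even≡k (+-mono-≤ (≤-pred #odd<2) (≤-trans #even≤1+#odd #odd<2))))

  2≤#even : 2 ≤ #even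
  2≤#even = ≤-trans 2≤#odd #odd≤#even

  1<k-2 : 1 < k-2
  1<k-2 = ≤-trans (s≤s (s≤s z≤n)) 3≤k-2

  k≤#cyc : k ≤ #cyc
  k≤#cyc = m≤n*m k k-2 {{ℕ.>-nonZero (<-trans (s≤s z≤n) 1<k-2)}}

  0<#cyc : 0 < #cyc
  0<#cyc = ≤-trans (s≤s z≤n) k≤#cyc

  -- Needed for the lemmas about the last vertex pred #cyc of the cyclic run.
  instance
    #cyc-nonZero : NonZero #cyc
    #cyc-nonZero = ℕ.>-nonZero 0<#cyc

  m≡runs : m ≡ #odd + #cyc + #even
  m≡runs = begin
    k * suc k-2          ≡⟨ *-suc k k-2 ⟩
    k + k * k-2          ≡⟨ cong₂ _+_ (sym #odd+#even≡k) (*-comm k k-2) ⟩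
    #odd + #even + #cyc  ≡⟨ +-assoc #odd #even #cyc ⟩
    #odd + (#even + #cyc) ≡⟨ cong (#odd +_) (+-comm #even #cyc) ⟩
    #odd + (#cyc + #even) ≡⟨ +-assoc #odd #cyc #even ⟨
    #odd + #cyc + #even  ∎
    where open ≡-Reasoning

  #odd+#cyc<m : #odd + #cyc < m
  #odd+#cyc<m = subst (#odd + #cyc <_) (sym m≡runs) (m<m+n (#odd + #cyc) (≤-trans (s≤s z≤n) 2≤#even))

  odd-colour<k : ∀ {s} → s < #odd → suc (s + s) < k
  odd-colour<k {s} s<#odd = begin
    suc (suc (s + s))  ≡⟨ double-suc s ⟨
    suc s + suc s      ≤⟨ +-mono-≤ s<#odd (≤-trans s<#odd #odd≤#even) ⟩
    #odd + #even       ≡⟨ #odd+#even≡k ⟩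
    k                  ∎
    where open ≤-Reasoning

  even-colour<k : ∀ {q} → q < #even → q + q < k
  even-colour<k {q} q<#even = ≤-pred (begin
    suc (suc (q + q))  ≡⟨ double-suc q ⟨
    suc q + suc q      ≤⟨ +-mono-≤ (≤-trans q<#even #even≤1+#odd) q<#even ⟩
    suc (#odd + #even) ≡⟨ cong suc #odd+#even≡k ⟩
    suc k              ∎)
    where open ≤-Reasoning

  layout : ℕ → ℕ × ℕ
  layout i with i <? #odd
  ... | yes _ = suc ((#odd ∸ suc i) + (#odd ∸ suc i)) , k-1
  ... | no _ with i <? #odd + #cyc
  ...   | yes _ = (i ∸ #odd) % k , k-2 ∸ (i ∸ #odd) / k
  ...   | no _  = (i ∸ (#odd + #cyc)) + (i ∸ (#odd + #cyc)) , k-1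

  P offset L : ℕ → ℕ
  P i      = proj₁ (layout i)
  offset i = proj₂ (layout i)
  L i      = P i ⊕ offset i

  cyc-offset : ℕ → ℕ
  cyc-offset j = k-2 ∸ j / k

  -- Vertex i lies on the odd run at distance s from its end when #odd ≡ s + suc i.
  odd-position : ∀ {s i} → #odd ≡ s + suc i → i < #odd × s < #odd
  odd-position {s} {i} eq = subst (i <_) (sym eq) (m≤n+m (suc i) s) ,
    subst (s <_) (sym eq) (subst (s <_) (sym (+-suc s i)) (s≤s (m≤m+n s i)))

  layout-odd : ∀ {s i} → #odd ≡ s + suc i → layout i ≡ (suc (s + s) , k-1)
  layout-odd {s} {i} eq with i <? #odd
  ... | yes _ = cong (λ t → suc (t + t) , k-1) (trans (cong (_∸ suc i) eq) (m+n∸n≡m s (suc i)))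
  ... | no i≮#odd = ⊥-elim (i≮#odd (proj₁ (odd-position eq)))

  layout-cyc : ∀ {j} → j < #cyc → layout (#odd + j) ≡ (j % k , cyc-offset j)
  layout-cyc {j} j<#cyc with #odd + j <? #odd
  ... | yes lt = ⊥-elim (m+n≮m #odd j lt)
  ... | no _ with #odd + j <? #odd + #cyc
  ...   | yes _ = cong (λ t → t % k , k-2 ∸ t / k) (m+n∸m≡n #odd j)
  ...   | no ge = ⊥-elim (ge (+-monoʳ-< #odd j<#cyc))

  layout-even : ∀ q → layout (#odd + #cyc + q) ≡ (q + q , k-1)
  layout-even q with #odd + #cyc + q <? #odd
  ... | yes lt = ⊥-elim (m+n≮m #odd (#cyc + q) (subst (_< #odd) (+-assoc #odd #cyc q) lt))
  ... | no _ with #odd + #cyc + q <? #odd + #cyc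
  ...   | yes lt = ⊥-elim (m+n≮m (#odd + #cyc) q lt)
  ...   | no _ = cong (λ t → t + t , k-1) (m+n∸m≡n (#odd + #cyc) q)

  P-odd : ∀ {s i} → #odd ≡ s + suc i → P i ≡ suc (s + s)
  P-odd eq = cong proj₁ (layout-odd eq)

  P-cyc : ∀ {j} → j < #cyc → P (#odd + j) ≡ j % k
  P-cyc j<#cyc = cong proj₁ (layout-cyc j<#cyc)

  P-even : ∀ q → P (#odd + #cyc + q) ≡ q + q
  P-even q = cong proj₁ (layout-even q)

  -- The odd and even runs, where the leaf offset is k − 1.
  data Sparse (i : ℕ) : Set where
    odd-run  : ∀ s → #odd ≡ s + suc i → Sparse i
    even-run : ∀ q → q < #even → i ≡ #odd + #cyc + q → Sparse i

  data Region (i : ℕ) : Set where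
    cyc-run : ∀ j → j < #cyc → i ≡ #odd + j → Region i
    sparse  : Sparse i → Region i

  region : ∀ {i} → i < m → Region i
  region {i} i<m with i <? #odd
  ... | yes i<#odd = sparse (odd-run (#odd ∸ suc i) (sym (m∸n+n≡m i<#odd)))
  ... | no i≮#odd with i <? #odd + #cyc
  ...   | yes lt = cyc-run (i ∸ #odd) (+-cancelˡ-< #odd _ _ (subst (_< #odd + #cyc) i≡ lt)) i≡
    where i≡ = sym (m+[n∸m]≡n (≮⇒≥ i≮#odd))
  ...   | no ge = sparse (even-run (i ∸ (#odd + #cyc))
                    (+-cancelˡ-< (#odd + #cyc) _ _ (subst₂ _<_ i≡ m≡runs i<m)) i≡)
    where i≡ = sym (m+[n∸m]≡n (≮⇒≥ ge))

  offset-sparse : ∀ {i} → Sparse i → offset i ≡ k-1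
  offset-sparse (odd-run s eq)      = cong proj₂ (layout-odd eq)
  offset-sparse (even-run q _ refl) = cong proj₂ (layout-even q)

  offset-cyc : ∀ {j} → j < #cyc → offset (#odd + j) ≡ cyc-offset j
  offset-cyc j<#cyc = cong proj₂ (layout-cyc j<#cyc)

  -- Colour ranges: P i < k, and every leaf offset lies in 1 … k−1 (so that
  -- leaf and stem differ), with the cyclic offsets never reaching k−1.
  cyc-offset<k-1 : ∀ j → cyc-offset j < k-1
  cyc-offset<k-1 j = s≤s (m∸n≤m k-2 (j / k))

  cyc-offset<k : ∀ j → cyc-offset j < k
  cyc-offset<k j = <-trans (cyc-offset<k-1 j) (n<1+n k-1)

  P<k : ∀ {i} → i < m → P i < k
  P<k i<m with region i<m
  ... | cyc-run j j<#cyc refl            = subst (_< k) (sym (P-cyc j<#cyc)) (m%n<n j k)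
  ... | sparse (odd-run s eq)            = subst (_< k) (sym (P-odd eq)) (odd-colour<k (proj₂ (odd-position eq)))
  ... | sparse (even-run q q<#even refl) = subst (_< k) (sym (P-even q)) (even-colour<k q<#even)

  offset-range : ∀ {i} → i < m → 0 < offset i × offset i < k
  offset-range i<m with region i<m
  ... | cyc-run j j<#cyc refl = subst (λ d → 0 < d × d < k) (sym (offset-cyc j<#cyc))
                                  (m<n⇒0<n∸m (m<n*o⇒m/o<n j<#cyc) , cyc-offset<k j)
  ... | sparse sp             = subst (λ d → 0 < d × d < k) (sym (offset-sparse sp)) (s≤s z≤n , n<1+n k-1)

  L-sparse : ∀ {i} → Sparse i → L i ≡ P i ⊕ k-1
  L-sparse {i} sp = cong (P i ⊕_) (offset-sparse sp)

  L-odd : ∀ {s i} → #odd ≡ s + suc i → L i ≡ s + s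
  L-odd eq = trans (L-sparse (odd-run _ eq))
    (trans (cong (_⊕ k-1) (P-odd eq)) (⊕-pred (s≤s z≤n) (odd-colour<k (proj₂ (odd-position eq)))))

  L-even-first : L (#odd + #cyc + 0) ≡ k-1
  L-even-first = trans (L-sparse (even-run 0 (≤-trans (s≤s z≤n) 2≤#even) refl))
    (trans (cong (_⊕ k-1) (P-even 0)) (m<n⇒m%n≡m (n<1+n k-1)))

  L-even-suc : ∀ {q} → suc q < #even → L (#odd + #cyc + suc q) ≡ q + suc q
  L-even-suc {q} q+1<#even = trans (L-sparse (even-run (suc q) q+1<#even refl))
    (trans (cong (_⊕ k-1) (P-even (suc q))) (⊕-pred (s≤s z≤n) (even-colour<k q+1<#even)))

  L-cyc : ∀ {j} → j < #cyc → L (#odd + j) ≡ j % k ⊕ cyc-offset j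
  L-cyc j<#cyc = cong₂ _⊕_ (P-cyc j<#cyc) (offset-cyc j<#cyc)

  -- Colours of path neighbours.  In the cyclic run the neighbours of a vertex
  -- of colour c have colours c ⊕ (k−1) and c ⊕ 1, also across both junctions.
  cyc-next : ∀ {j} → j < #cyc → P (suc (#odd + j)) ≡ j % k ⊕ 1
  cyc-next {j} j<#cyc with suc j <? #cyc
  ... | yes j+1<#cyc = begin
    P (suc (#odd + j))  ≡⟨ cong P (+-suc #odd j) ⟨
    P (#odd + suc j)    ≡⟨ P-cyc j+1<#cyc ⟩
    suc j % k           ≡⟨ cong (_% k) (+-comm 1 j) ⟩
    (j + 1) % k         ≡⟨ %-⊕ j 1 ⟩
    j % k ⊕ 1           ∎
    where open ≡-Reasoning
  ... | no j+1≮#cyc = begin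
    P (suc (#odd + j))   ≡⟨ cong P junction ⟩
    P (#odd + #cyc + 0)  ≡⟨ P-even 0 ⟩
    0                    ≡⟨ m*n%n≡0 k-2 k ⟨
    #cyc % k             ≡⟨ cong (_% k) (trans (+-comm j 1) j+1≡#cyc) ⟨
    (j + 1) % k          ≡⟨ %-⊕ j 1 ⟩
    j % k ⊕ 1            ∎
    where
    open ≡-Reasoning
    j+1≡#cyc : suc j ≡ #cyc
    j+1≡#cyc = ≤-antisym j<#cyc (≮⇒≥ j+1≮#cyc)
    junction : suc (#odd + j) ≡ #odd + #cyc + 0
    junction = trans (sym (+-suc #odd j)) (trans (cong (#odd +_) j+1≡#cyc) (sym (+-identityʳ _)))

  cyc-prev : ∀ {j} → suc j < #cyc → P (pred (#odd + suc j)) ≡ suc j % k ⊕ k-1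
  cyc-prev {j} j+1<#cyc = begin
    P (pred (#odd + suc j))  ≡⟨ cong (P ∘ pred) (+-suc #odd j) ⟩
    P (#odd + j)             ≡⟨ P-cyc (<-trans (n<1+n j) j+1<#cyc) ⟩
    j % k                    ≡⟨ [m+n]%n≡m%n j k ⟨
    (j + k) % k              ≡⟨ cong (_% k) (+-suc j k-1) ⟩
    (suc j + k-1) % k        ≡⟨ %-⊕ (suc j) k-1 ⟩
    suc j % k ⊕ k-1          ∎
    where open ≡-Reasoning

  cyc-first-prev : P (pred (#odd + 0)) ≡ 0 % k ⊕ 1
  cyc-first-prev = trans (cong (P ∘ pred) (+-identityʳ #odd))
    (P-odd {0} (sym (suc-pred #odd {{ℕ.>-nonZero (≤-trans (s≤s z≤n) 2≤#odd)}})))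

  odd-next : ∀ {s i} → #odd ≡ suc s + suc i → P (suc i) ≡ suc (s + s)
  odd-next {s} {i} eq = P-odd {s} (trans eq (sym (+-suc s (suc i))))

  odd-prev : ∀ {s i} → #odd ≡ s + suc (suc i) → P i ≡ suc (suc s + suc s)
  odd-prev {s} {i} eq = P-odd {suc s} (trans eq (+-suc s (suc i)))

  odd-junction : ∀ {i} → #odd ≡ suc i → P (suc i) ≡ 0
  odd-junction eq = trans (cong P (trans (sym eq) (sym (+-identityʳ #odd)))) (P-cyc 0<#cyc)

  even-next : ∀ q → P (suc (#odd + #cyc + q)) ≡ suc q + suc q
  even-next q = trans (cong P (sym (+-suc (#odd + #cyc) q))) (P-even (suc q))

  even-prev : ∀ q → P (pred (#odd + #cyc + suc q)) ≡ q + q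
  even-prev q = trans (cong (P ∘ pred) (+-suc (#odd + #cyc) q)) (P-even q)

  even-junction : P (pred (#odd + #cyc + 0)) ≡ k-1
  even-junction = begin
    P (pred (#odd + #cyc + 0))  ≡⟨ cong (P ∘ pred) position ⟩
    P (#odd + pred #cyc)        ≡⟨ P-cyc {pred #cyc} (subst (pred #cyc <_) (suc-pred #cyc) (n<1+n _)) ⟩
    pred #cyc % k               ≡⟨ %-pred-≡0 {pred #cyc} (trans (cong (_% k) (suc-pred #cyc)) (m*n%n≡0 k-2 k)) ⟩
    k-1                         ∎
    where
    open ≡-Reasoning
    position : #odd + #cyc + 0 ≡ suc (#odd + pred #cyc)
    position = trans (+-identityʳ _) (trans (cong (#odd +_) (sym (suc-pred #cyc))) (+-suc #odd _))

  Sees : ℕ → ℕ → Set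
  Sees = PathSees m P L

  SeesTwo : ℕ → Set
  SeesTwo i = ∃₂ λ x y → Sees i x × Sees i y × x ≢ y

  cyc<m : ∀ {j} → j < #cyc → #odd + j < m
  cyc<m j<#cyc = <-trans (+-monoʳ-< #odd j<#cyc) #odd+#cyc<m

  cyc-sees : ∀ {j x} → j < #cyc → Sees (#odd + j) x →
             x ≡ j % k ⊕ k-1 ⊎ x ≡ j % k ⊕ 1 ⊎ x ≡ j % k ⊕ cyc-offset j
  cyc-sees         j<#cyc (inj₁ refl)               = inj₂ (inj₂ (L-cyc j<#cyc))
  cyc-sees {zero}  _      (inj₂ (inj₁ (_ , refl)))  = inj₂ (inj₁ cyc-first-prev)
  cyc-sees {suc j} j<#cyc (inj₂ (inj₁ (_ , refl)))  = inj₁ (cyc-prev j<#cyc)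
  cyc-sees         j<#cyc (inj₂ (inj₂ (_ , refl)))  = inj₂ (inj₁ (cyc-next j<#cyc))

  cyc-sees-next : ∀ {j} → j < #cyc → Sees (#odd + j) (j % k ⊕ 1)
  cyc-sees-next {j} j<#cyc = inj₂ (inj₂ (next<m , sym (cyc-next j<#cyc)))
    where
    next<m : suc (#odd + j) < m
    next<m = subst (_< m) (+-suc #odd j)
      (≤-<-trans (+-monoʳ-≤ #odd j<#cyc) #odd+#cyc<m)

  cyc-cancel : ∀ j {d d′} → d < k → d′ < k → j % k ⊕ d ≡ j % k ⊕ d′ → d ≡ d′
  cyc-cancel j = ⊕-cancelˡ (<⇒≤ (m%n<n j k))

  cyc-sees-two : ∀ j → j < #cyc → SeesTwo (#odd + j)
  cyc-sees-two j j<#cyc with cyc-offset j ≟ 1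
  cyc-sees-two j j<#cyc | no d≢1 =
    _ , _ , cyc-sees-next j<#cyc , inj₁ refl , λ eq →
      d≢1 (sym (cyc-cancel j (s≤s (s≤s z≤n)) (cyc-offset<k j) (trans eq (L-cyc j<#cyc))))
  cyc-sees-two zero _ | yes d≡1 = ⊥-elim (<⇒≢ 1<k-2 (sym d≡1))
  cyc-sees-two (suc j) j<#cyc | yes _ =
    _ , _ , inj₂ (inj₁ (≤-trans (s≤s z≤n) (m≤n+m (suc j) #odd) , refl)) , cyc-sees-next j<#cyc , λ eq →
      <⇒≢ (s≤s (≤-trans (s≤s z≤n) 1<k-2)) (sym (cyc-cancel (suc j) (n<1+n k-1) (s≤s (s≤s z≤n))
        (trans (sym (cyc-prev j<#cyc)) eq)))

  Odd : ℕ → Set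
  Odd x = ∃ λ u → x ≡ suc (u + u)

  odd-sees : ∀ {s i x} → #odd ≡ s + suc i → Sees i x → x ≡ s + s ⊎ Odd x ⊎ (s ≡ 0 × x ≡ 0)
  odd-sees               eq (inj₁ refl)              = inj₁ (L-odd eq)
  odd-sees {s} {suc i}   eq (inj₂ (inj₁ (_ , refl))) = inj₂ (inj₁ (suc s , odd-prev eq))
  odd-sees {suc s}       eq (inj₂ (inj₂ (_ , refl))) = inj₂ (inj₁ (s , odd-next eq))
  odd-sees {zero}        eq (inj₂ (inj₂ (_ , refl))) = inj₂ (inj₂ (refl , odd-junction eq))

  -- The colour following 2s+1 is even, so it is not seen on the odd run.
  odd-misses-next : ∀ {s i x} → #odd ≡ s + suc i → Sees i x → x ≢ suc (s + s) ⊕ 1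
  odd-misses-next {s} eq sees x≡ with ⊕-suc (odd-colour<k (proj₂ (odd-position eq))) | odd-sees eq sees
  ... | inj₁ next≡ | inj₁ x≡2s              = m≢1+n+m (s + s) {1} (trans (sym x≡2s) (trans x≡ next≡))
  ... | inj₁ next≡ | inj₂ (inj₁ (u , x≡odd)) =
    odd≢even u (suc s) (trans (sym x≡odd) (trans x≡ (trans next≡ (sym (double-suc s)))))
  ... | inj₁ next≡ | inj₂ (inj₂ (_ , x≡0))   = 0≢1+n (trans (sym x≡0) (trans x≡ next≡))
  ... | inj₂ (2s+2≡k , next≡0) | inj₁ x≡2s   =
    k≢small (s≤s (s≤s (s≤s z≤n))) (trans (sym 2s+2≡k) (cong (suc ∘ suc) (trans (sym x≡2s) (trans x≡ next≡0))))
  ... | inj₂ (_ , next≡0) | inj₂ (inj₁ (u , x≡odd)) = 0≢1+n (trans (sym (trans x≡ next≡0)) x≡odd)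
  ... | inj₂ (2s+2≡k , _) | inj₂ (inj₂ (s≡0 , _))   =
    k≢small (s≤s (s≤s (s≤s z≤n))) (trans (sym 2s+2≡k) (cong (λ t → suc (suc (t + t))) s≡0))

  odd-sees-two : ∀ {s i} → #odd ≡ s + suc i → SeesTwo i
  odd-sees-two {s} {suc i} eq = _ , _ , inj₁ refl , inj₂ (inj₁ (s≤s z≤n , refl)) , λ L≡P →
    odd≢even (suc s) s (sym (trans (sym (L-odd eq)) (trans L≡P (odd-prev eq))))
  odd-sees-two {zero}  {zero} eq = ⊥-elim (<⇒≱ (s≤s (s≤s z≤n)) (subst (2 ≤_) eq 2≤#odd))
  odd-sees-two {suc s} {zero} eq = _ , _ , inj₁ refl , inj₂ (inj₂ (1<m , refl)) , λ L≡P →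
    odd≢even s (suc s) (sym (trans (sym (L-odd {suc s} eq)) (trans L≡P (odd-next eq))))
    where
    1<m : 1 < m
    1<m = ≤-trans 2≤#odd (≤-trans (m≤m+n #odd #cyc) (<⇒≤ #odd+#cyc<m))

  even-sees : ∀ {q x} → q < #even → Sees (#odd + #cyc + q) x →
              (q ≡ 0 × x ≡ k-1) ⊎ suc x ≡ q + q ⊎ x + 2 ≡ q + q ⊎ x ≡ suc q + suc q
  even-sees {zero}  _       (inj₁ refl)              = inj₁ (refl , L-even-first)
  even-sees {suc q} q<#even (inj₁ refl)              = inj₂ (inj₁ (cong suc (L-even-suc q<#even)))
  even-sees {zero}  _       (inj₂ (inj₁ (_ , refl))) = inj₁ (refl , even-junction)
  even-sees {suc q} _       (inj₂ (inj₁ (_ , refl))) =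
    inj₂ (inj₂ (inj₁ (trans (cong (_+ 2) (even-prev q)) (trans (+-comm (q + q) 2) (sym (double-suc q))))))
  even-sees {q}     _       (inj₂ (inj₂ (_ , refl))) = inj₂ (inj₂ (inj₂ (even-next q)))

  even-misses-next : ∀ {q x} → q < #even → Sees (#odd + #cyc + q) x → x ≢ (q + q) ⊕ 1
  even-misses-next {q} q<#even sees x≡ with ⊕-suc (even-colour<k q<#even) | even-sees q<#even sees
  ... | inj₁ next≡ | inj₁ (refl , x≡k-1) =
    k≢small (s≤s (s≤s (s≤s z≤n))) (cong suc (trans (sym x≡k-1) (trans x≡ next≡)))
  ... | inj₁ next≡ | inj₂ (inj₁ x+1≡)          =
    m≢1+n+m (q + q) {1} (trans (sym x+1≡) (cong suc (trans x≡ next≡)))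
  ... | inj₁ next≡ | inj₂ (inj₂ (inj₁ x+2≡))   =
    m≢1+m+n (q + q) {2} (trans (sym x+2≡) (cong (_+ 2) (trans x≡ next≡)))
  ... | inj₁ next≡ | inj₂ (inj₂ (inj₂ x≡next)) =
    odd≢even q (suc q) (trans (sym (trans x≡ next≡)) x≡next)
  ... | inj₂ (_ , next≡0) | inj₁ (_ , x≡k-1)   = 0≢1+n (trans (sym (trans x≡ next≡0)) x≡k-1)
  ... | inj₂ (_ , next≡0) | inj₂ (inj₁ x+1≡)   = odd≢even 0 q (trans (cong suc (sym (trans x≡ next≡0))) x+1≡)
  ... | inj₂ (2q+1≡k , next≡0) | inj₂ (inj₂ (inj₁ x+2≡)) =
    k≢small (s≤s (s≤s (s≤s (s≤s z≤n)))) (trans (sym 2q+1≡k) (cong (λ t → suc (t + t)) (sym q≡1)))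
    where
    q≡1 : 1 ≡ q
    q≡1 = double-injective (trans (cong (_+ 2) (sym (trans x≡ next≡0))) x+2≡)
  ... | inj₂ (_ , next≡0) | inj₂ (inj₂ (inj₂ x≡next)) = 0≢1+n (trans (sym (trans x≡ next≡0)) x≡next)

  even-sees-two : ∀ {q} → q < #even → SeesTwo (#odd + #cyc + q)
  even-sees-two {zero} _ = _ , _ , inj₁ refl , inj₂ (inj₂ (next<m , refl)) , λ L≡P →
    k≢small (s≤s (s≤s (s≤s (s≤s z≤n)))) (cong suc (trans (sym L-even-first) (trans L≡P (even-next 0))))
    where
    next<m : suc (#odd + #cyc + 0) < m
    next<m = subst₂ _<_ (+-suc (#odd + #cyc) 0) (sym m≡runs) (+-monoʳ-< (#odd + #cyc) 2≤#even)
  even-sees-two {suc q} q<#even =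
    _ , _ , inj₁ refl , inj₂ (inj₁ (subst (0 <_) (sym (+-suc (#odd + #cyc) q)) (s≤s z≤n) , refl)) , λ L≡P →
      odd≢even q q (trans (sym (+-suc q q)) (trans (sym (L-even-suc q<#even)) (trans L≡P (even-prev q))))

  sparse-sees-two : ∀ {i} → Sparse i → SeesTwo i
  sparse-sees-two (odd-run s eq)            = odd-sees-two eq
  sparse-sees-two (even-run q q<#even refl) = even-sees-two q<#even

  sparse-misses-next : ∀ {i x} → Sparse i → Sees i x → x ≢ P i ⊕ 1
  sparse-misses-next (odd-run s eq) sees x≡ =
    odd-misses-next eq sees (trans x≡ (cong (_⊕ 1) (P-odd eq)))
  sparse-misses-next (even-run q q<#even refl) sees x≡ =
    even-misses-next q<#even sees (trans x≡ (cong (_⊕ 1) (P-even q)))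

  sparse-injective : ∀ {i j} → Sparse i → Sparse j → P i ≡ P j → i ≡ j
  sparse-injective {i} {j} (odd-run s eq) (odd-run s′ eq′) Pi≡Pj =
    suc-injective (+-cancelˡ-≡ s _ _ (trans (sym eq) (trans eq′ (cong (_+ suc j) (sym s≡s′)))))
    where
    s≡s′ : s ≡ s′
    s≡s′ = double-injective (suc-injective (trans (sym (P-odd eq)) (trans Pi≡Pj (P-odd eq′))))
  sparse-injective (odd-run s eq) (even-run q _ refl) Pi≡Pj =
    ⊥-elim (odd≢even s q (trans (sym (P-odd eq)) (trans Pi≡Pj (P-even q))))
  sparse-injective (even-run q _ refl) (odd-run s eq) Pi≡Pj =
    ⊥-elim (odd≢even s q (trans (sym (P-odd eq)) (trans (sym Pi≡Pj) (P-even q))))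
  sparse-injective (even-run q _ refl) (even-run q′ _ refl) Pi≡Pj =
    cong (#odd + #cyc +_) (double-injective (trans (sym (P-even q)) (trans Pi≡Pj (P-even q′))))

  cyc-injective : ∀ {j j′} → j < #cyc → j′ < #cyc → j % k ≡ j′ % k → cyc-offset j ≡ cyc-offset j′ → j ≡ j′
  cyc-injective {j} {j′} j<#cyc j′<#cyc same-colour same-offset = begin
    j                    ≡⟨ m≡m%n+[m/n]*n j k ⟩
    j % k + j / k * k    ≡⟨ cong₂ (λ r t → r + t * k) same-colour same-sweep ⟩
    j′ % k + j′ / k * k  ≡⟨ m≡m%n+[m/n]*n j′ k ⟨
    j′                   ∎
    where
    open ≡-Reasoning
    same-sweep : j / k ≡ j′ / k
    same-sweep = ∸-cancelˡ-≡ (<⇒≤ (m<n*o⇒m/o<n j<#cyc)) (<⇒≤ (m<n*o⇒m/o<n j′<#cyc)) same-offset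

  cyc-leaf-offset : ∀ {j j′ d} → j < #cyc → j % k ≡ j′ % k → d < k →
                    L (#odd + j) ≡ j′ % k ⊕ d → cyc-offset j ≡ d
  cyc-leaf-offset {j} {j′} j<#cyc same-colour d<k L≡ = cyc-cancel j′ (cyc-offset<k j) d<k
    (trans (cong (_⊕ cyc-offset j) (sym same-colour)) (trans (sym (L-cyc j<#cyc)) L≡))

  cyc-leaf-unseen : ∀ {j j′} → j < #cyc → j′ < #cyc → j % k ≡ j′ % k →
                    cyc-offset j ≢ 1 → cyc-offset j ≢ cyc-offset j′ → ¬ Sees (#odd + j′) (L (#odd + j))
  cyc-leaf-unseen {j} {j′} j<#cyc j′<#cyc same-colour d≢1 d≢d′ sees with cyc-sees j′<#cyc sees
  ... | inj₁ x≡        = <⇒≢ (cyc-offset<k-1 j) (cyc-leaf-offset {j′ = j′} j<#cyc same-colour (n<1+n k-1) x≡)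
  ... | inj₂ (inj₁ x≡) = d≢1 (cyc-leaf-offset {j′ = j′} j<#cyc same-colour (s≤s (s≤s z≤n)) x≡)
  ... | inj₂ (inj₂ x≡) = d≢d′ (cyc-leaf-offset {j′ = j′} j<#cyc same-colour (cyc-offset<k j′) x≡)

  -- Two distinct cyclic-run vertices of the same colour: one whose offset is
  -- not 1 sees its leaf colour, which the other one does not see.
  cyc-separated : ∀ {j j′} → j < #cyc → j′ < #cyc → j ≢ j′ → j % k ≡ j′ % k →
                  ∃ λ x → (Sees (#odd + j) x × ¬ Sees (#odd + j′) x) ⊎ (Sees (#odd + j′) x × ¬ Sees (#odd + j) x)
  cyc-separated {j} {j′} j<#cyc j′<#cyc j≢j′ same-colour with cyc-offset j ≟ 1
  ... | no d≢1  = _ , inj₁ (inj₁ refl ,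
    cyc-leaf-unseen j<#cyc j′<#cyc same-colour d≢1 (j≢j′ ∘ cyc-injective j<#cyc j′<#cyc same-colour))
  ... | yes d≡1 = _ , inj₂ (inj₁ refl ,
    cyc-leaf-unseen j′<#cyc j<#cyc (sym same-colour) (λ d′≡1 → d≢d′ (trans d≡1 (sym d′≡1))) (d≢d′ ∘ sym))
    where
    d≢d′ : cyc-offset j ≢ cyc-offset j′
    d≢d′ = j≢j′ ∘ cyc-injective j<#cyc j′<#cyc same-colour

  path-proper : ∀ {i} → suc i < m → P i ≢ P (suc i)
  path-proper {i} i+1<m Pi≡ with region (<-trans (n<1+n i) i+1<m)
  ... | cyc-run j j<#cyc refl = 0≢1+n (cyc-cancel j (s≤s z≤n) (s≤s (s≤s z≤n))
    (trans (⊕-identityʳ (m%n<n j k)) (trans (sym (P-cyc j<#cyc)) (trans Pi≡ (cyc-next j<#cyc)))))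
  ... | sparse (odd-run zero eq) = 1+n≢0 (trans (sym (P-odd {0} eq)) (trans Pi≡ (odd-junction eq)))
  ... | sparse (odd-run (suc s) eq) = m≢1+n+m (s + s) {1}
    (sym (trans (sym (double-suc s)) (suc-injective (trans (sym (P-odd {suc s} eq)) (trans Pi≡ (odd-next eq))))))
  ... | sparse (even-run q _ refl) =
    m≢1+n+m (q + q) {1} (trans (sym (P-even q)) (trans Pi≡ (trans (even-next q) (double-suc q))))

  leaf-proper : ∀ {i} → i < m → L i ≢ P i
  leaf-proper {i} i<m Li≡Pi = <⇒≢ (proj₁ (offset-range i<m))
    (sym (⊕-cancelˡ (<⇒≤ (P<k i<m)) (proj₂ (offset-range i<m)) (s≤s z≤n)
      (trans Li≡Pi (sym (⊕-identityʳ (P<k i<m))))))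

  same-offset : ∀ {i j} → i < m → j < m → P i ≡ P j → L i ≡ L j → offset i ≡ offset j
  same-offset {i} {j} i<m j<m Pi≡Pj Li≡Lj = ⊕-cancelˡ (<⇒≤ (P<k i<m))
    (proj₂ (offset-range i<m)) (proj₂ (offset-range j<m)) (trans Li≡Lj (cong (_⊕ offset j) (sym Pi≡Pj)))

  leaf-separated : ∀ {i j} → i < m → j < m → P i ≡ P j → L i ≡ L j → i ≡ j
  leaf-separated i<m j<m Pi≡Pj Li≡Lj with region i<m | region j<m | same-offset i<m j<m Pi≡Pj Li≡Lj
  ... | cyc-run j₁ l₁ refl | cyc-run j₂ l₂ refl | d≡ = cong (#odd +_) (cyc-injective l₁ l₂
    (trans (sym (P-cyc l₁)) (trans Pi≡Pj (P-cyc l₂))) (trans (sym (offset-cyc l₁)) (trans d≡ (offset-cyc l₂))))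
  ... | cyc-run j₁ l₁ refl | sparse sp | d≡ =
    ⊥-elim (<⇒≢ (cyc-offset<k-1 j₁) (trans (sym (offset-cyc l₁)) (trans d≡ (offset-sparse sp))))
  ... | sparse sp | cyc-run j₂ l₂ refl | d≡ =
    ⊥-elim (<⇒≢ (cyc-offset<k-1 j₂) (trans (sym (offset-cyc l₂)) (trans (sym d≡) (offset-sparse sp))))
  ... | sparse sp | sparse sp′ | _ = sparse-injective sp sp′ Pi≡Pj

  path-sees-two : ∀ {i} → i < m → SeesTwo i
  path-sees-two i<m with region i<m
  ... | cyc-run j j<#cyc refl = cyc-sees-two j j<#cyc
  ... | sparse sp             = sparse-sees-two sp

  -- Same-coloured path vertices on different kinds of runs are told apart by
  -- the next colour P ⊕ 1, which only the cyclic-run vertex sees.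
  path-separated : ∀ {i j} → i < m → j < m → i ≢ j → P i ≡ P j →
                   ∃ λ x → (Sees i x × ¬ Sees j x) ⊎ (Sees j x × ¬ Sees i x)
  path-separated i<m j<m i≢j Pi≡Pj with region i<m | region j<m
  ... | cyc-run j₁ l₁ refl | cyc-run j₂ l₂ refl =
    cyc-separated l₁ l₂ (i≢j ∘ cong (#odd +_)) (trans (sym (P-cyc l₁)) (trans Pi≡Pj (P-cyc l₂)))
  ... | cyc-run j₁ l₁ refl | sparse sp = _ , inj₁ (cyc-sees-next l₁ , λ sees →
    sparse-misses-next sp sees (cong (_⊕ 1) (trans (sym (P-cyc l₁)) Pi≡Pj)))
  ... | sparse sp | cyc-run j₂ l₂ refl = _ , inj₂ (cyc-sees-next l₂ , λ sees →
    sparse-misses-next sp sees (cong (_⊕ 1) (trans (sym (P-cyc l₂)) (sym Pi≡Pj))))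
  ... | sparse sp | sparse sp′ = ⊥-elim (i≢j (sparse-injective sp sp′ Pi≡Pj))

  path-onto : ∀ {x} → x < k → ∃ λ i → i < m × P i ≡ x
  path-onto x<k = _ , cyc<m x<#cyc , trans (P-cyc x<#cyc) (m<n⇒m%n≡m x<k)
    where x<#cyc = <-≤-trans x<k k≤#cyc

  locating-pattern : LocatingPattern m k P L
  locating-pattern = record
    { path<k         = P<k
    ; leaf<k         = λ {i} _ → ⊕<n (P i) (offset i)
    ; path-proper    = path-proper
    ; leaf-proper    = leaf-proper
    ; leaf-separated = leaf-separated
    ; path-sees-two  = path-sees-two
    ; path-separated = path-separated
    ; path-onto      = path-onto
    }

⌈n/2⌉≤1+⌊n/2⌋ : ∀ n → ⌈ n /2⌉ ≤ suc ⌊ n /2⌋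
⌈n/2⌉≤1+⌊n/2⌋ zero          = z≤n
⌈n/2⌉≤1+⌊n/2⌋ (suc zero)    = s≤s z≤n
⌈n/2⌉≤1+⌊n/2⌋ (suc (suc n)) = s≤s (⌈n/2⌉≤1+⌊n/2⌋ n)

proposition22 : (k : ℕ) → 5 ≤ k → NLColoring (Comb (k * (k ∸ 1))) k
proposition22 k@(suc (suc k-2)) (s≤s (s≤s 3≤k-2)) = pattern⇒NLColoring locating-pattern
  where
  open Construction k-2 3≤k-2 ⌊ k /2⌋ ⌈ k /2⌉ (⌊n/2⌋+⌈n/2⌉≡n k) (⌊n/2⌋≤⌈n/2⌉ k) (⌈n/2⌉≤1+⌊n/2⌋ k)
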